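{- Let $G=(V,E)$ be a graph on $n$ vertices that has a perfect matching, and fix a perfect matching $\mathrm{OPT}$ of $G$. Let $0\le c\le 1/6$ and let $k=(1/2-3c)\cdot n/2$, assumed to be a nonnegative integer. If the expected size of the matching $R$ output by \textsc{Ranking} on $G$ is at most $(1/2+c)\cdot n/2$, then the expected number of $k$-wasteful independent sets in the output of \textsc{Ranking} (with respect to $\mathrm{OPT}$) is at least one.
   Context: The \textsc{Ranking} algorithm on $G$: draw a permutation $\pi$ of $V$ uniformly at random; iterate over the vertices in the order of $\pi$, and when processing a still-unmatched vertex, match it to its first (in the order of $\pi$) currently unmatched neighbor, if any; the output is the resulting (maximal) matching $R$. An augmenting path for $R$ is a path whose edges alternate between edges of $\mathrm{OPT}$ and edges of $R$ and whose two endpoints are unmatched in $R$; a length-three augmenting path consists of an $\mathrm{OPT}$ edge, an $R$ edge, and an $\mathrm{OPT}$ edge. Given the output $R$, a set $I$ of $2k$ vertices is a $k$-wasteful independent set ($k$-WIS) if the vertices of $I$ are exactly the $2k$ endpoints of $k$ (vertex-disjoint) length-three augmenting paths in $R\oplus \mathrm{OPT}$. (Such $I$ is an independent set of $G$ since $R$ is maximal and vertices of $I$ are unmatched.) -}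

module Defs where

open import Data.Nat using (ℕ; zero; suc; _!) renaming (_<?_ to _<ℕ?_)
open import Data.Nat.Properties using (_!≢0)
open import Data.Fin using (Fin; toℕ; _≟_)
open import Data.Fin.Subset using (Subset; ∣_∣) renaming (_∈_ to _∈ˢ_)
open import Data.List using (List; []; _∷_; map; concatMap; allFin; filter; length; cartesianProduct)
open import Data.Nat.ListAction using (sum)
open import Data.List.Membership.Propositional using (_∈_)
open import Data.List.Relation.Unary.Unique.Propositional using (Unique)
open import Data.Maybe using (Maybe; just; nothing)
import Data.Maybe.Properties as MaybeP
open import Data.Product using (Σ; Σ-syntax; ∃; _×_; _,_)
open import Data.Product.Properties using ()
open import Data.Sum using (_⊎_)
open import Data.Integer using (+_)
open import Data.Rational using (ℚ; _/_)
open import Relation.Nullary using (Dec; yes; no; ¬_)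
open import Relation.Nullary.Decidable using (_×-dec_)
open import Relation.Binary.PropositionalEquality using (_≡_; _≢_)
open import Relation.Binary.Definitions using (Decidable)
open import Function.Bundles using (_⇔_)

-- Graphs on the vertex set V = Fin n.  A (simple, undirected) graph is a
-- decidable, symmetric, irreflexive adjacency relation.

Symmetric′ : ∀ {n} → (Fin n → Fin n → Set) → Set
Symmetric′ E = ∀ u v → E u v → E v u

Irreflexive′ : ∀ {n} → (Fin n → Fin n → Set) → Set
Irreflexive′ E = ∀ v → ¬ E v v

-- A perfect matching given by its partner function: every vertex v is
-- matched to opt v, via an edge of G; opt is a fixed-point-free involution.
IsPerfectMatching : ∀ {n} → (Fin n → Fin n → Set) → (Fin n → Fin n) → Set
IsPerfectMatching E opt =
  (∀ v → E v (opt v)) × (∀ v → opt (opt v) ≡ v) × (∀ v → opt v ≢ v)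

-- Permutations of V, listed as orderings (each ordering exactly once).

insertAll : ∀ {A : Set} → A → List A → List (List A)
insertAll x []       = (x ∷ []) ∷ []
insertAll x (y ∷ ys) = (x ∷ y ∷ ys) ∷ map (y ∷_) (insertAll x ys)

permutations : ∀ {A : Set} → List A → List (List A)
permutations []       = [] ∷ []
permutations (x ∷ xs) = concatMap (insertAll x) (permutations xs)

orders : (n : ℕ) → List (List (Fin n))
orders n = permutations (allFin n)

-- The Ranking algorithm.  A matching state is a partial "mate" function:
-- mate v ≡ nothing means v is unmatched, mate v ≡ just u means {u,v} ∈ R.

Mate : ℕ → Set
Mate n = Fin n → Maybe (Fin n)

module Ranking {n : ℕ} {E : Fin n → Fin n → Set} (E? : Decidable E) where

  firstFree : Mate n → Fin n → List (Fin n) → Maybe (Fin n)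
  firstFree m v [] = nothing
  firstFree m v (u ∷ us) with E? v u | m u
  ... | yes _ | nothing = just u
  ... | _     | _       = firstFree m v us

  assign : Mate n → Fin n → Fin n → Mate n
  assign m v u w with w ≟ v | w ≟ u
  ... | yes _ | _     = just u
  ... | no _  | yes _ = just v
  ... | no _  | no _  = m w

  step : List (Fin n) → Mate n → Fin n → Mate n
  step σ m v with m v
  ... | just _  = m
  ... | nothing with firstFree m v σ
  ...   | nothing = m
  ...   | just u  = assign m v u

  process : List (Fin n) → Mate n → List (Fin n) → Mate n
  process σ m []       = m
  process σ m (v ∷ vs) = process σ (step σ m v) vs

  ranking : List (Fin n) → Mate n
  ranking σ = process σ (λ _ → nothing) σ

  sizeR : List (Fin n) → ℕ
  sizeR σ = length (filter isEdge (cartesianProduct (allFin n) (allFin n)))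
    where
    isEdge : (p : Fin n × Fin n) → Dec (toℕ (Data.Product.proj₁ p) Data.Nat.< toℕ (Data.Product.proj₂ p)
                                        × ranking σ (Data.Product.proj₁ p) ≡ just (Data.Product.proj₂ p))
    isEdge (u , v) = (toℕ u <ℕ? toℕ v) ×-dec MaybeP.≡-dec _≟_ (ranking σ u) (just v)

record AugPath3 {n : ℕ} (opt : Fin n → Fin n) (R : Mate n) : Set where
  field
    a b c d : Fin n
    ab∈OPT  : opt a ≡ b
    bc∈R    : R b ≡ just c
    cd∈OPT  : opt c ≡ d
    a-free  : R a ≡ nothing
    d-free  : R d ≡ nothing

OnPath : ∀ {n opt R} → AugPath3 {n} opt R → Fin n → Set
OnPath p v = v ≡ AugPath3.a p ⊎ v ≡ AugPath3.b p ⊎ v ≡ AugPath3.c p ⊎ v ≡ AugPath3.d p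

Endpoint : ∀ {n opt R} → AugPath3 {n} opt R → Fin n → Set
Endpoint p v = v ≡ AugPath3.a p ⊎ v ≡ AugPath3.d p

IsKWIS : ∀ {n} → (opt : Fin n → Fin n) → (R : Mate n) → ℕ → Subset n → Set
IsKWIS {n} opt R k I =
  ∣ I ∣ ≡ 2 Data.Nat.* k ×
  Σ[ P ∈ (Fin k → AugPath3 opt R) ]
    ((∀ i j → i ≢ j → ∀ v → OnPath (P i) v → OnPath (P j) v → Data.Empty.⊥) ×
     (∀ v → (v ∈ˢ I) ⇔ (∃ λ i → Endpoint (P i) v)))
  where import Data.Empty

-- "Exactly m objects satisfy P": m is the length of a duplicate-free list
-- whose members are exactly the objects satisfying P.

IsCount : ∀ {A : Set} → (A → Set) → ℕ → Set
IsCount {A} P m = Σ[ L ∈ List A ] (Unique L × (∀ x → (x ∈ L) ⇔ P x) × length L ≡ m)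

-- Expectation over a uniformly random permutation π of V (n! orderings).

Expect : (n : ℕ) → (List (Fin n) → ℕ) → ℚ
Expect n f = (+ sum (map f (orders n))) / (n !) where instance _ = n !≢0

ℚ[_] : ℕ → ℚ
ℚ[ m ] = (+ m) / 1

{-# OPTIONS --safe #-}
-- Fix an order σ and let R be the matching output by Ranking; it contains an endpoint of every
-- OPT edge. A free vertex a starts the alternating walk a, opt a, c, opt c, where c is the
-- R-partner of opt a; it is a length-three augmenting path when opt c is free as well, and such
-- paths are vertex-disjoint. Counting vertices (opt maps the free vertices, and R ∘ opt the free
-- vertices whose walk ends at a matched vertex, injectively into disjoint sets of matched
-- vertices) gives n ≤ r + 3|R| for r such paths. Any k of them form a k-WIS, and fixing k - 1 of
-- them while varying the last one gives r - k + 1 distinct ones, so n < #WIS + k + 3|R| for k ≥ 1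
-- (for k = 0 the empty set is a 0-WIS). Averaging over σ, k + 3 E|R| ≤ n by the choice of k and
-- the bound on E|R|, hence E[#WIS] ≥ 1.
module Submission where

open import Defs
open import Data.Nat using (ℕ)
open import Data.Fin using (Fin)
open import Data.List using (List)
open import Data.List.Membership.Propositional using (_∈_)
open import Data.Maybe using (just; nothing)
open import Data.Product using (_×_)
open import Relation.Binary.PropositionalEquality using (_≡_; _≢_)
open import Relation.Binary.Definitions using (Decidable)

module UniqueLists where
  open import Data.Nat using (suc; _≤_; _+_; z≤n; s≤s)
  open import Data.Nat.Properties using (≤-antisym; +-suc; module ≤-Reasoning)
  open import Data.Fin using (zero; suc)
  open import Data.List using ([]; _∷_; _++_; map; length; lookup)
  open import Data.List.Properties using (length-++)
  open import Data.List.Membership.Propositional using (_∉_)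
  open import Data.List.Membership.Propositional.Properties using (∈-∃++; ∈-lookup; ∈-++⁺ˡ; ∈-++⁺ʳ)
  open import Data.List.Relation.Binary.Subset.Propositional using (_⊆_)
  open import Data.List.Relation.Unary.Unique.Propositional using (Unique; []; _∷_)
  open import Data.List.Relation.Unary.All as All using (All; []; _∷_)
  open import Data.List.Relation.Unary.All.Properties using (map⁺)
  open import Data.List.Relation.Unary.Any using (here; there)
  open import Data.Product using (_×_; _,_)
  open import Data.Empty using (⊥-elim)
  open import Function.Bundles using (Equivalence)
  open import Relation.Binary.PropositionalEquality using (_≢_; refl; sym; cong)

  module _ {A : Set} where

    ∈-++-∷⁻ : ∀ {x y : A} xs ys → y ∈ xs ++ x ∷ ys → y ≢ x → y ∈ xs ++ ys
    ∈-++-∷⁻ []       ys (here refl) y≢x = ⊥-elim (y≢x refl)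
    ∈-++-∷⁻ []       ys (there y∈)  y≢x = y∈
    ∈-++-∷⁻ (z ∷ xs) ys (here refl) y≢x = here refl
    ∈-++-∷⁻ (z ∷ xs) ys (there y∈)  y≢x = there (∈-++-∷⁻ xs ys y∈ y≢x)

    Unique⇒length≤ : ∀ {xs ys : List A} → Unique xs → xs ⊆ ys → length xs ≤ length ys
    Unique⇒length≤ {[]}     _          _   = z≤n
    Unique⇒length≤ {x ∷ xs} (x∉ ∷ uxs) xs⊆ with ys₁ , ys₂ , refl ← ∈-∃++ (xs⊆ (here refl)) = begin
      suc (length xs)               ≤⟨ s≤s (Unique⇒length≤ uxs xs⊆ys₁ys₂) ⟩
      suc (length (ys₁ ++ ys₂))     ≡⟨ cong suc (length-++ ys₁) ⟩
      suc (length ys₁ + length ys₂) ≡⟨ +-suc (length ys₁) (length ys₂) ⟨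
      length ys₁ + length (x ∷ ys₂) ≡⟨ length-++ ys₁ ⟨
      length (ys₁ ++ x ∷ ys₂)       ∎
      where
      open ≤-Reasoning
      xs⊆ys₁ys₂ : xs ⊆ ys₁ ++ ys₂
      xs⊆ys₁ys₂ y∈ = ∈-++-∷⁻ ys₁ ys₂ (xs⊆ (there y∈)) (λ y≡x → All.lookup x∉ y∈ (sym y≡x))

    Unique⇒length≡ : ∀ {xs ys : List A} → Unique xs → Unique ys → xs ⊆ ys → ys ⊆ xs →
                     length xs ≡ length ys
    Unique⇒length≡ uxs uys xs⊆ys ys⊆xs =
      ≤-antisym (Unique⇒length≤ uxs xs⊆ys) (Unique⇒length≤ uys ys⊆xs)

    Unique-++⁻ : ∀ xs {ys : List A} → Unique (xs ++ ys) →
                 Unique xs × Unique ys × (∀ {v} → v ∈ xs → v ∉ ys)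
    Unique-++⁻ []       uys         = [] , uys , λ ()
    Unique-++⁻ (x ∷ xs) (x∉ ∷ uxsys) with uxs , uys , xs#ys ← Unique-++⁻ xs uxsys =
      All.tabulate (λ y∈ → All.lookup x∉ (∈-++⁺ˡ y∈)) ∷ uxs , uys ,
      λ { (here refl) v∈ys → All.lookup x∉ (∈-++⁺ʳ xs v∈ys) refl ; (there v∈xs) → xs#ys v∈xs }

    lookup-injective : ∀ {xs : List A} → Unique xs → ∀ {i j} → lookup xs i ≡ lookup xs j → i ≡ j
    lookup-injective (_  ∷ _)   {zero}  {zero}  _  = refl
    lookup-injective (x∉ ∷ _)   {zero}  {suc j} eq = ⊥-elim (All.lookup x∉ (∈-lookup j) eq)
    lookup-injective (x∉ ∷ _)   {suc i} {zero}  eq = ⊥-elim (All.lookup x∉ (∈-lookup i) (sym eq))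
    lookup-injective (_  ∷ uxs) {suc i} {suc j} eq = cong suc (lookup-injective uxs eq)

  module _ {A B : Set} (f : A → B) where

    map⁺-on : ∀ {xs} → (∀ {x y} → x ∈ xs → y ∈ xs → f x ≡ f y → x ≡ y) →
              Unique xs → Unique (map f xs)
    map⁺-on {[]}     _   []          = []
    map⁺-on {x ∷ xs} inj (x∉ ∷ uxs) =
      map⁺ (All.tabulate fx≢) ∷ map⁺-on (λ p q → inj (there p) (there q)) uxs
      where
      fx≢ : ∀ {y} → y ∈ xs → f x ≢ f y
      fx≢ y∈ eq = All.lookup x∉ y∈ (inj (here refl) (there y∈) eq)

  IsCount⇒length≤ : ∀ {A : Set} {P : A → Set} {m xs} → IsCount P m →
                    Unique xs → (∀ {x} → x ∈ xs → P x) → length xs ≤ m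
  IsCount⇒length≤ (L , _ , L⇔P , refl) uxs P-xs =
    Unique⇒length≤ uxs (λ {x} x∈ → Equivalence.from (L⇔P x) (P-xs x∈))

module Permutations where
  open import Data.Nat using (suc; _+_; _*_; _!)
  open import Data.Nat.Properties using (*-comm)
  open import Data.List using ([]; _∷_; concatMap; length; allFin)
  open import Data.List.Properties using (length-++; length-map; length-tabulate)
  open import Data.List.Membership.Propositional.Properties using (∈-map⁻; ∈-concatMap⁻; ∈-allFin)
  open import Data.List.Membership.Propositional using (find)
  open import Data.List.Relation.Binary.Subset.Propositional using (_⊆_)
  open import Data.List.Relation.Unary.Any using (here; there)
  open import Data.Product using (_×_; _,_; proj₁; proj₂)
  open import Relation.Binary.PropositionalEquality using (refl; trans; cong; cong₂; module ≡-Reasoning)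
  open import Function using (id; _∘_)

  module _ {A B : Set} where

    length-concatMap-const : ∀ (f : A → List B) xs {c} → (∀ {x} → x ∈ xs → length (f x) ≡ c) →
                             length (concatMap f xs) ≡ length xs * c
    length-concatMap-const f []       _  = refl
    length-concatMap-const f (x ∷ xs) hf = trans (length-++ (f x))
      (cong₂ _+_ (hf (here refl)) (length-concatMap-const f xs (hf ∘ there)))

  module _ {A : Set} where

    ∈-insertAll⁻ : ∀ (x : A) ys {zs} → zs ∈ insertAll x ys → x ∈ zs × ys ⊆ zs
    ∈-insertAll⁻ x []       (here refl) = here refl , λ ()
    ∈-insertAll⁻ x (y ∷ ys) (here refl) = here refl , there
    ∈-insertAll⁻ x (y ∷ ys) (there zs∈) with zs , zs∈ , refl ← ∈-map⁻ (y ∷_) zs∈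
      with x∈ , ys⊆ ← ∈-insertAll⁻ x ys zs∈ =
      there x∈ , λ { (here refl) → here refl ; (there y∈) → there (ys⊆ y∈) }

    length-∈-insertAll : ∀ (x : A) ys {zs} → zs ∈ insertAll x ys → length zs ≡ suc (length ys)
    length-∈-insertAll x []       (here refl) = refl
    length-∈-insertAll x (y ∷ ys) (here refl) = refl
    length-∈-insertAll x (y ∷ ys) (there zs∈) with zs , zs∈ , refl ← ∈-map⁻ (y ∷_) zs∈ =
      cong suc (length-∈-insertAll x ys zs∈)

    length-insertAll : ∀ (x : A) ys → length (insertAll x ys) ≡ suc (length ys)
    length-insertAll x []       = refl
    length-insertAll x (y ∷ ys) =
      cong suc (trans (length-map (y ∷_) (insertAll x ys)) (length-insertAll x ys))

    ∈-permutations⁻ : ∀ (xs : List A) {ys} → ys ∈ permutations xs → xs ⊆ ys × length ys ≡ length xs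
    ∈-permutations⁻ []       (here refl) = (λ ()) , refl
    ∈-permutations⁻ (x ∷ xs) ys∈ with zs , zs∈ , ys∈ins ← find (∈-concatMap⁻ (insertAll x) ys∈)
      with x∈ys , zs⊆ys ← ∈-insertAll⁻ x zs ys∈ins | xs⊆zs , zs≡xs ← ∈-permutations⁻ xs zs∈ =
      (λ { (here refl) → x∈ys ; (there y∈) → zs⊆ys (xs⊆zs y∈) }) ,
      trans (length-∈-insertAll x zs ys∈ins) (cong suc zs≡xs)

    length-permutations : ∀ (xs : List A) → length (permutations xs) ≡ length xs !
    length-permutations []       = refl
    length-permutations (x ∷ xs) = begin
      length (concatMap (insertAll x) (permutations xs))
        ≡⟨ length-concatMap-const (insertAll x) (permutations xs) length-insertAll-∈ ⟩
      length (permutations xs) * suc (length xs)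
        ≡⟨ cong (_* suc (length xs)) (length-permutations xs) ⟩
      length xs ! * suc (length xs)
        ≡⟨ *-comm (length xs !) (suc (length xs)) ⟩
      suc (length xs) !  ∎
      where
      open ≡-Reasoning
      length-insertAll-∈ : ∀ {ys} → ys ∈ permutations xs → length (insertAll x ys) ≡ suc (length xs)
      length-insertAll-∈ {ys} ys∈ =
        trans (length-insertAll x ys) (cong suc (proj₂ (∈-permutations⁻ xs ys∈)))

  ∈-orders : ∀ {n σ} → σ ∈ orders n → ∀ v → v ∈ σ
  ∈-orders {n} σ∈ v = proj₁ (∈-permutations⁻ (allFin n) σ∈) (∈-allFin v)

  length-orders : ∀ n → length (orders n) ≡ n !
  length-orders n = trans (length-permutations (allFin n)) (cong _! (length-tabulate {n = n} id))

module Sums where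
  open import Data.Nat using (ℕ; _+_; _*_; _≤_; z≤n)
  open import Data.Nat.Properties
    using (+-mono-≤; *-distribˡ-+; *-zeroʳ; +-commutativeSemigroup; module ≤-Reasoning)
  open import Function using (_∘_)
  open import Algebra.Properties.CommutativeSemigroup +-commutativeSemigroup using (interchange)
  open import Data.Nat.ListAction using (sum)
  open import Data.List using ([]; _∷_; map; length)
  open import Data.List.Relation.Unary.Any using (here; there)
  open import Relation.Binary.PropositionalEquality using (refl; sym; trans; cong)

  module _ {A : Set} where

    sum-map-+ : ∀ (f g : A → ℕ) xs → sum (map (λ x → f x + g x) xs) ≡ sum (map f xs) + sum (map g xs)
    sum-map-+ f g []       = refl
    sum-map-+ f g (x ∷ xs) = trans (cong (f x + g x +_) (sum-map-+ f g xs)) (interchange (f x) (g x) _ _)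

    sum-map-*ˡ : ∀ c (f : A → ℕ) xs → sum (map (λ x → c * f x) xs) ≡ c * sum (map f xs)
    sum-map-*ˡ c f []       = sym (*-zeroʳ c)
    sum-map-*ˡ c f (x ∷ xs) = trans (cong (c * f x +_) (sum-map-*ˡ c f xs)) (sym (*-distribˡ-+ c (f x) _))

    sum-map-lowerBound : ∀ {a b} (f : A → ℕ) xs → (∀ {x} → x ∈ xs → a ≤ f x + b) →
                         length xs * a ≤ sum (map f xs) + length xs * b
    sum-map-lowerBound         f []       _     = z≤n
    sum-map-lowerBound {a} {b} f (x ∷ xs) a≤f+b = begin
      a + length xs * a
        ≤⟨ +-mono-≤ (a≤f+b (here refl)) (sum-map-lowerBound f xs (a≤f+b ∘ there)) ⟩
      (f x + b) + (sum (map f xs) + length xs * b)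
        ≡⟨ interchange (f x) b _ _ ⟩
      (f x + sum (map f xs)) + (b + length xs * b) ∎
      where open ≤-Reasoning

module NatArithmetic where
  open import Data.Nat using (suc; _+_; _*_; _≤_)
  open import Data.Nat.Properties
    using ( *-cancelˡ-≤; *-monoʳ-≤; +-mono-≤; +-monoˡ-≤; +-monoʳ-≤; +-cancelʳ-≤; +-assoc; +-comm; *-suc
          ; module ≤-Reasoning)
  open import Data.Nat.Tactic.RingSolver using (solve-∀)
  open import Relation.Binary.PropositionalEquality using (_≡_; cong)

  vertex-count-bound : ∀ {n F M G B A P} →
                       n ≤ F + M → F ≤ G + B → F + B ≤ M → G ≤ 2 * A → M ≤ 2 * P → n ≤ A + 3 * P
  vertex-count-bound {n} {F} {M} {G} {B} {A} {P} n≤F+M F≤G+B F+B≤M G≤2A M≤2P = *-cancelˡ-≤ 2 (begin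
    2 * n               ≤⟨ *-monoʳ-≤ 2 n≤F+M ⟩
    2 * (F + M)         ≡⟨ regroup₁ F M ⟩
    (F + F) + 2 * M     ≤⟨ +-monoˡ-≤ (2 * M) F+F≤G+M ⟩
    (G + M) + 2 * M     ≡⟨ regroup₂ G M ⟩
    G + 3 * M           ≤⟨ +-mono-≤ G≤2A (*-monoʳ-≤ 3 M≤2P) ⟩
    2 * A + 3 * (2 * P) ≡⟨ regroup₃ A P ⟩
    2 * (A + 3 * P)     ∎)
    where
    open ≤-Reasoning
    F+F≤G+M : F + F ≤ G + M
    F+F≤G+M = begin
      F + F       ≤⟨ +-monoˡ-≤ F F≤G+B ⟩
      G + B + F   ≡⟨ +-assoc G B F ⟩
      G + (B + F) ≡⟨ cong (G +_) (+-comm B F) ⟩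
      G + (F + B) ≤⟨ +-monoʳ-≤ G F+B≤M ⟩
      G + M       ∎
    regroup₁ : ∀ F M → 2 * (F + M) ≡ (F + F) + 2 * M
    regroup₁ = solve-∀
    regroup₂ : ∀ G M → (G + M) + 2 * M ≡ G + 3 * M
    regroup₂ = solve-∀
    regroup₃ : ∀ A P → 2 * A + 3 * (2 * P) ≡ 2 * (A + 3 * P)
    regroup₃ = solve-∀

  cancel-budget : ∀ {N n K T W} → N * suc n ≤ (W + T) + N * K → N * K + T ≤ N * n → N ≤ W
  cancel-budget {N} {n} {K} {T} {W} N[1+n]≤ budget = +-cancelʳ-≤ (N * n) N W (begin
    N + N * n       ≡⟨ *-suc N n ⟨
    N * suc n       ≤⟨ N[1+n]≤ ⟩
    (W + T) + N * K ≡⟨ regroup W T (N * K) ⟩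
    W + (N * K + T) ≤⟨ +-monoʳ-≤ W budget ⟩
    W + N * n       ∎)
    where
    open ≤-Reasoning
    regroup : ∀ W T U → (W + T) + U ≡ W + (U + T)
    regroup = solve-∀

module ListSubsets where
  open UniqueLists
  open import Data.Nat using (ℕ; suc)
  open import Data.Fin using (Fin; zero; suc; _≟_)
  open import Data.Fin.Subset using (Subset; ∣_∣) renaming (_∈_ to _∈ˢ_)
  open import Data.Vec as Vec using ()
  open import Data.Vec.Properties using (lookup∘tabulate; lookup⇒[]=; []=⇒lookup)
  open import Data.List as List using (filter; length; allFin)
  open import Data.List.Membership.Propositional.Properties using (∈-filter⁺; ∈-filter⁻; ∈-allFin)
  open import Data.List.Relation.Unary.Unique.Propositional using (Unique)
  open import Data.List.Relation.Unary.Unique.Propositional.Properties using (filter⁺; allFin⁺)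
  open import Data.Product using (proj₂)
  open import Function using (id)
  open import Relation.Nullary using (Dec; yes; no; does)
  open import Relation.Nullary.Decidable using (dec-true)
  open import Relation.Binary.PropositionalEquality using (refl; trans; sym; cong)

  ∣tabulate∣≡length-filter : ∀ {n} {A : Set} {P : A → Set} (P? : ∀ x → Dec (P x)) (g : Fin n → A) →
                             ∣ Vec.tabulate (λ i → does (P? (g i))) ∣ ≡ length (filter P? (List.tabulate g))
  ∣tabulate∣≡length-filter {0}     P? g = refl
  ∣tabulate∣≡length-filter {suc n} P? g with P? (g zero)
  ... | yes _ = cong suc (∣tabulate∣≡length-filter P? (λ i → g (suc i)))
  ... | no  _ = ∣tabulate∣≡length-filter P? (λ i → g (suc i))

  module _ {n : ℕ} where
    open import Data.List.Membership.DecPropositional (_≟_ {n}) using (_∈?_)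

    toSubset : List (Fin n) → Subset n
    toSubset xs = Vec.tabulate (λ v → does (v ∈? xs))

    ∣toSubset∣ : ∀ {xs} → Unique xs → ∣ toSubset xs ∣ ≡ length xs
    ∣toSubset∣ {xs} uxs = trans (∣tabulate∣≡length-filter (_∈? xs) id)
      (Unique⇒length≡ (filter⁺ (_∈? xs) (allFin⁺ n)) uxs
        (λ v∈ → proj₂ (∈-filter⁻ (_∈? xs) {xs = allFin n} v∈))
        (∈-filter⁺ (_∈? xs) (∈-allFin _)))

    ∈toSubset⁺ : ∀ xs {v} → v ∈ xs → v ∈ˢ toSubset xs
    ∈toSubset⁺ xs {v} v∈ = lookup⇒[]= v _ (trans (lookup∘tabulate _ v) (dec-true (v ∈? xs) v∈))

    ∈toSubset⁻ : ∀ xs {v} → v ∈ˢ toSubset xs → v ∈ xs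
    ∈toSubset⁻ xs {v} v∈ˢ with v ∈? xs | trans (sym (lookup∘tabulate _ v)) ([]=⇒lookup v∈ˢ)
    ... | yes v∈ | _ = v∈

module RationalArithmetic where
  import Data.Nat as ℕ
  import Data.Nat.Properties as ℕₚ
  open import Data.Nat using (ℕ; suc; NonZero)
  open import Data.Integer as ℤ using (+_; +≤+)
  import Data.Integer.Properties as ℤ
  open import Data.Rational using (ℚ; 1ℚ; ½; _≤_; _+_; _-_; _*_; _/_; toℚᵘ)
  open import Data.Rational.Properties
    using ( toℚᵘ-injective; toℚᵘ-fromℚᵘ; toℚᵘ-homo-+; toℚᵘ-homo-*; toℚᵘ-mono-≤; toℚᵘ-cancel-≤
          ; normalize-nonNeg; *-monoˡ-≤-nonNeg; +-monoʳ-≤; module ≤-Reasoning)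
  open import Data.Rational.Unnormalised as ℚᵘ using (ℚᵘ; mkℚᵘ; *≡*; *≤*; _≃_)
  open import Data.Rational.Unnormalised.Properties as ℚᵘ
    using (≃-sym; ≤-respˡ-≃; ≤-respʳ-≃; module ≃-Reasoning)
  open import Data.Rational.Solver using (module +-*-Solver)
  open import Relation.Binary.PropositionalEquality using (refl; sym; trans; cong; cong₂)

  private
    ι : ℕ → ℚᵘ
    ι a = mkℚᵘ (+ a) 0

    toℚᵘ-ℚ[] : ∀ a → toℚᵘ ℚ[ a ] ≃ ι a
    toℚᵘ-ℚ[] a = toℚᵘ-fromℚᵘ (ι a)

  ℚ[]-+ : ∀ a b → ℚ[ a ] + ℚ[ b ] ≡ ℚ[ a ℕ.+ b ]
  ℚ[]-+ a b = toℚᵘ-injective (begin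
    toℚᵘ (ℚ[ a ] + ℚ[ b ])       ≈⟨ toℚᵘ-homo-+ ℚ[ a ] ℚ[ b ] ⟩
    toℚᵘ ℚ[ a ] ℚᵘ.+ toℚᵘ ℚ[ b ] ≈⟨ ℚᵘ.+-cong (toℚᵘ-ℚ[] a) (toℚᵘ-ℚ[] b) ⟩
    ι a ℚᵘ.+ ι b                 ≈⟨ *≡* ι-+ ⟩
    ι (a ℕ.+ b)                  ≈⟨ toℚᵘ-ℚ[] (a ℕ.+ b) ⟨
    toℚᵘ ℚ[ a ℕ.+ b ]            ∎)
    where
    open ≃-Reasoning
    ι-+ : (+ a ℤ.* + 1 ℤ.+ + b ℤ.* + 1) ℤ.* + 1 ≡ + (a ℕ.+ b) ℤ.* + 1
    ι-+ rewrite ℤ.*-identityʳ (+ a) | ℤ.*-identityʳ (+ b) | ℤ.*-identityʳ (+ (a ℕ.+ b)) = refl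

  ℚ[]-* : ∀ a b → ℚ[ a ] * ℚ[ b ] ≡ ℚ[ a ℕ.* b ]
  ℚ[]-* a b = toℚᵘ-injective (begin
    toℚᵘ (ℚ[ a ] * ℚ[ b ])       ≈⟨ toℚᵘ-homo-* ℚ[ a ] ℚ[ b ] ⟩
    toℚᵘ ℚ[ a ] ℚᵘ.* toℚᵘ ℚ[ b ] ≈⟨ ℚᵘ.*-cong (toℚᵘ-ℚ[] a) (toℚᵘ-ℚ[] b) ⟩
    ι a ℚᵘ.* ι b                 ≈⟨ *≡* ι-* ⟩
    ι (a ℕ.* b)                  ≈⟨ toℚᵘ-ℚ[] (a ℕ.* b) ⟨
    toℚᵘ ℚ[ a ℕ.* b ]            ∎)
    where
    open ≃-Reasoning
    ι-* : (+ a ℤ.* + b) ℤ.* + 1 ≡ + (a ℕ.* b) ℤ.* + 1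
    ι-* rewrite ℤ.*-identityʳ (+ a ℤ.* + b) | ℤ.*-identityʳ (+ (a ℕ.* b)) = sym (ℤ.pos-* a b)

  ℚ[]-cancel-≤ : ∀ {a b} → ℚ[ a ] ≤ ℚ[ b ] → a ℕ.≤ b
  ℚ[]-cancel-≤ {a} {b} a≤b
    with *≤* a≤b ← ≤-respʳ-≃ (toℚᵘ-ℚ[] b) (≤-respˡ-≃ (toℚᵘ-ℚ[] a) (toℚᵘ-mono-≤ a≤b))
    rewrite ℤ.*-identityʳ (+ a) | ℤ.*-identityʳ (+ b) = ℤ.drop‿+≤+ a≤b

  /-*-ℚ[] : ∀ S N .{{_ : NonZero N}} → ((+ S) / N) * ℚ[ N ] ≡ ℚ[ S ]
  /-*-ℚ[] S (suc N) = toℚᵘ-injective (begin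
    toℚᵘ ((+ S) / suc N * ℚ[ suc N ])          ≈⟨ toℚᵘ-homo-* ((+ S) / suc N) ℚ[ suc N ] ⟩
    toℚᵘ ((+ S) / suc N) ℚᵘ.* toℚᵘ ℚ[ suc N ] ≈⟨ ℚᵘ.*-cong (toℚᵘ-fromℚᵘ (mkℚᵘ (+ S) N)) (toℚᵘ-ℚ[] (suc N)) ⟩
    mkℚᵘ (+ S) N ℚᵘ.* ι (suc N)               ≈⟨ *≡* cross ⟩
    ι S                                       ≈⟨ toℚᵘ-ℚ[] S ⟨
    toℚᵘ ℚ[ S ]                               ∎)
    where
    open ≃-Reasoning
    cross : (+ S ℤ.* + suc N) ℤ.* + 1 ≡ + S ℤ.* + (suc N ℕ.* 1)
    cross rewrite ℤ.*-identityʳ (+ S ℤ.* + suc N) | ℕₚ.*-identityʳ N = refl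

  1≤/ : ∀ S N .{{_ : NonZero N}} → N ℕ.≤ S → 1ℚ ≤ (+ S) / N
  1≤/ S (suc N) N≤S = toℚᵘ-cancel-≤ (≤-respʳ-≃ (≃-sym (toℚᵘ-fromℚᵘ (mkℚᵘ (+ S) N))) (*≤* cross))
    where
    cross : + 1 ℤ.* + suc N ℤ.≤ + S ℤ.* + 1
    cross rewrite ℤ.*-identityˡ (+ suc N) | ℤ.*-identityʳ (+ S) = +≤+ N≤S

  budget : ∀ (x q e c : ℚ) → q ≡ (½ - ℚ[ 3 ] * c) * (x * ½) → e ≤ (½ + c) * (x * ½) →
           q + ℚ[ 3 ] * e ≤ x
  budget x q e c q≡ e≤ = begin
    q + ℚ[ 3 ] * e                                             ≤⟨ +-monoʳ-≤ q (*-monoˡ-≤-nonNeg ℚ[ 3 ] e≤) ⟩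
    q + ℚ[ 3 ] * y                                             ≡⟨ cong (_+ ℚ[ 3 ] * y) q≡ ⟩
    (½ - ℚ[ 3 ] * c) * (x * ½) + ℚ[ 3 ] * ((½ + c) * (x * ½)) ≡⟨ c-cancels ⟩
    x                                                          ∎
    where
    open ≤-Reasoning
    open +-*-Solver
    y : ℚ
    y = (½ + c) * (x * ½)
    c-cancels : (½ - ℚ[ 3 ] * c) * (x * ½) + ℚ[ 3 ] * ((½ + c) * (x * ½)) ≡ x
    c-cancels = solve 2 (λ c x → (con ½ :- con ℚ[ 3 ] :* c) :* (x :* con ½)
                                 :+ con ℚ[ 3 ] :* ((con ½ :+ c) :* (x :* con ½)) := x) refl c x

  scaled-budget : ∀ {n k} N S .{{_ : NonZero N}} (c : ℚ) →
                  ℚ[ k ] ≡ (½ - ℚ[ 3 ] * c) * (ℚ[ n ] * ½) → (+ S) / N ≤ (½ + c) * (ℚ[ n ] * ½) →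
                  N ℕ.* k ℕ.+ 3 ℕ.* S ℕ.≤ N ℕ.* n
  scaled-budget {n} {k} N S c k≡ e≤ = ℚ[]-cancel-≤ (begin
    ℚ[ N ℕ.* k ℕ.+ 3 ℕ.* S ]                ≡⟨ ℚ[]-homo ⟨
    ℚ[ N ] * ℚ[ k ] + ℚ[ 3 ] * ℚ[ S ]       ≡⟨ cong (λ s → ℚ[ N ] * ℚ[ k ] + ℚ[ 3 ] * s) (/-*-ℚ[] S N) ⟨
    ℚ[ N ] * ℚ[ k ] + ℚ[ 3 ] * (e * ℚ[ N ]) ≡⟨ factor-N ⟩
    ℚ[ N ] * (ℚ[ k ] + ℚ[ 3 ] * e)          ≤⟨ *-monoˡ-≤-nonNeg ℚ[ N ] {{normalize-nonNeg N 1}} k+3e≤n ⟩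
    ℚ[ N ] * ℚ[ n ]                         ≡⟨ ℚ[]-* N n ⟩
    ℚ[ N ℕ.* n ]                            ∎)
    where
    open ≤-Reasoning
    open +-*-Solver
    e : ℚ
    e = (+ S) / N
    k+3e≤n : ℚ[ k ] + ℚ[ 3 ] * e ≤ ℚ[ n ]
    k+3e≤n = budget ℚ[ n ] ℚ[ k ] e c k≡ e≤
    ℚ[]-homo : ℚ[ N ] * ℚ[ k ] + ℚ[ 3 ] * ℚ[ S ] ≡ ℚ[ N ℕ.* k ℕ.+ 3 ℕ.* S ]
    ℚ[]-homo = trans (cong₂ _+_ (ℚ[]-* N k) (ℚ[]-* 3 S)) (ℚ[]-+ (N ℕ.* k) (3 ℕ.* S))
    factor-N : ℚ[ N ] * ℚ[ k ] + ℚ[ 3 ] * (e * ℚ[ N ]) ≡ ℚ[ N ] * (ℚ[ k ] + ℚ[ 3 ] * e)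
    factor-N = solve 3 (λ N k e → N :* k :+ con ℚ[ 3 ] :* (e :* N) := N :* (k :+ con ℚ[ 3 ] :* e))
                       refl ℚ[ N ] ℚ[ k ] e

IsMatching : ∀ {n} → Mate n → Set
IsMatching m = ∀ u v → m u ≡ just v → m v ≡ just u × u ≢ v

module RankingMatching where
  open import Data.Nat using (ℕ)
  open import Data.Fin using (Fin; _≟_)
  open import Data.List using ([]; _∷_)
  open import Data.List.Relation.Unary.Any using (here; there)
  open import Data.Maybe using (just; nothing)
  open import Data.Product using (_×_; _,_)
  open import Data.Empty using (⊥-elim)
  open import Relation.Nullary using (yes; no)
  open import Relation.Binary.PropositionalEquality using (_≢_; refl; sym; trans; subst)
  open import Data.Maybe.Properties using (just-injective)
  open import Function using (case_of_)
  open import Relation.Binary.Definitions using (Decidable)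

  _⊑_ : ∀ {n} → Mate n → Mate n → Set
  m ⊑ m′ = ∀ w → m′ w ≡ nothing → m w ≡ nothing

  module _ {n : ℕ} {E : Fin n → Fin n → Set} (E? : Decidable E) where
    open Ranking E?

    Saturated : List (Fin n) → Mate n → Fin n → Set
    Saturated σ m v = m v ≡ nothing → ∀ u → u ∈ σ → E v u → m u ≢ nothing

    saturated-⊑ : ∀ {σ m m′ v} → m ⊑ m′ → Saturated σ m v → Saturated σ m′ v
    saturated-⊑ m⊑m′ sat v-free u u∈ e u-free = sat (m⊑m′ _ v-free) u u∈ e (m⊑m′ u u-free)

    firstFree-just : ∀ m v σ {u} → firstFree m v σ ≡ just u → m u ≡ nothing × E v u
    firstFree-just m v (x ∷ σ) eq with E? v x | m x in mx
    firstFree-just m v (x ∷ σ) refl | yes e | nothing = mx , e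
    ... | yes _ | just _ = firstFree-just m v σ eq
    ... | no  _ | _      = firstFree-just m v σ eq

    firstFree-nothing : ∀ m v σ → firstFree m v σ ≡ nothing → ∀ u → u ∈ σ → E v u → m u ≢ nothing
    firstFree-nothing m v (x ∷ σ) eq u u∈ e u-free with E? v x | m x in mx | u∈
    ... | yes _  | nothing | _         = case eq of λ ()
    ... | yes _  | just _  | here refl = case trans (sym mx) u-free of λ ()
    ... | yes _  | just _  | there u∈σ = firstFree-nothing m v σ eq u u∈σ e u-free
    ... | no v≁x | _       | here refl = v≁x e
    ... | no _   | _       | there u∈σ = firstFree-nothing m v σ eq u u∈σ e u-free

    assign-at-v : ∀ m v u → assign m v u v ≡ just u
    assign-at-v m v u with v ≟ v
    ... | yes _   = refl
    ... | no  v≢v = ⊥-elim (v≢v refl)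

    assign-at-u : ∀ m v u → u ≢ v → assign m v u u ≡ just v
    assign-at-u m v u u≢v with u ≟ v | u ≟ u
    ... | yes u≡v | _       = ⊥-elim (u≢v u≡v)
    ... | no  _   | yes _   = refl
    ... | no  _   | no  u≢u = ⊥-elim (u≢u refl)

    assign-elsewhere : ∀ m v u w → w ≢ v → w ≢ u → assign m v u w ≡ m w
    assign-elsewhere m v u w w≢v w≢u with w ≟ v | w ≟ u
    ... | yes w≡v | _       = ⊥-elim (w≢v w≡v)
    ... | no  _   | yes w≡u = ⊥-elim (w≢u w≡u)
    ... | no  _   | no  _   = refl

    assign-⊑ : ∀ m v u → m ⊑ assign m v u
    assign-⊑ m v u w w-free with w ≟ v | w ≟ u
    assign-⊑ m v u w () | yes _ | _
    assign-⊑ m v u w () | no  _ | yes _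
    ... | no  _ | no  _ = w-free

    assign-isMatching : ∀ m v u → IsMatching m → m v ≡ nothing → m u ≡ nothing → u ≢ v →
                        IsMatching (assign m v u)
    assign-isMatching m v u m-matching v-free u-free u≢v w x eq with w ≟ v | w ≟ u
    ... | yes refl | _ = subst (λ x → assign m w u x ≡ just w × w ≢ x) (just-injective eq)
                           (assign-at-u m w u u≢v , λ w≡u → u≢v (sym w≡u))
    ... | no  _    | yes refl = subst (λ x → assign m v w x ≡ just w × w ≢ x) (just-injective eq)
                           (assign-at-v m v w , u≢v)
    ... | no  w≢v  | no  w≢u with mx≡w , w≢x ← m-matching w x eq =
      trans (assign-elsewhere m v u x x≢v x≢u) mx≡w , w≢x
      where
      x≢v : x ≢ v
      x≢v refl with () ← trans (sym v-free) mx≡w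
      x≢u : x ≢ u
      x≢u refl with () ← trans (sym u-free) mx≡w

    step-⊑ : ∀ σ m v → m ⊑ step σ m v
    step-⊑ σ m v with m v
    ... | just _  = λ _ free → free
    ... | nothing with firstFree m v σ
    ...   | nothing = λ _ free → free
    ...   | just u  = assign-⊑ m v u

    step-saturates : ∀ σ m v → Saturated σ (step σ m v) v
    step-saturates σ m v with m v in mv
    ... | just _ = λ v-free → case trans (sym mv) v-free of λ ()
    ... | nothing with firstFree m v σ in ff
    ...   | nothing = λ _ → firstFree-nothing m v σ ff
    ...   | just u  = λ v-free → case trans (sym (assign-at-v m v u)) v-free of λ ()

    step-isMatching : Irreflexive′ E → ∀ σ m v → IsMatching m → IsMatching (step σ m v)
    step-isMatching irr σ m v m-matching with m v in mv
    ... | just _ = m-matching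
    ... | nothing with firstFree m v σ in ff
    ...   | nothing = m-matching
    ...   | just u with u-free , v∼u ← firstFree-just m v σ ff =
      assign-isMatching m v u m-matching mv u-free λ { refl → irr u v∼u }

    process-⊑ : ∀ σ m vs → m ⊑ process σ m vs
    process-⊑ σ m []       w free = free
    process-⊑ σ m (v ∷ vs) w free = step-⊑ σ m v w (process-⊑ σ (step σ m v) vs w free)

    process-saturates : ∀ σ m vs {v} → v ∈ vs → Saturated σ (process σ m vs) v
    process-saturates σ m (v ∷ vs) (here refl) =
      saturated-⊑ (process-⊑ σ (step σ m v) vs) (step-saturates σ m v)
    process-saturates σ m (_ ∷ vs) (there v∈) = process-saturates σ (step σ m _) vs v∈

    process-isMatching : Irreflexive′ E → ∀ σ m vs → IsMatching m → IsMatching (process σ m vs)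
    process-isMatching irr σ m []       m-matching = m-matching
    process-isMatching irr σ m (v ∷ vs) m-matching =
      process-isMatching irr σ (step σ m v) vs (step-isMatching irr σ m v m-matching)

    ranking-isMatching : Irreflexive′ E → ∀ σ → IsMatching (ranking σ)
    ranking-isMatching irr σ = process-isMatching irr σ (λ _ → nothing) σ (λ _ _ ())

    ranking-saturates : ∀ σ {v} → v ∈ σ → Saturated σ (ranking σ) v
    ranking-saturates σ = process-saturates σ (λ _ → nothing) σ

module AugmentingPaths {n : ℕ} (opt : Fin n → Fin n) (R : Mate n) (R-matching : IsMatching R)
  (opt-involutive : ∀ v → opt (opt v) ≡ v)
  (R-maximal : ∀ a → R a ≡ nothing → R (opt a) ≢ nothing) where

  open UniqueLists
  open ListSubsets
  open NatArithmetic
  import Data.Nat as ℕ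
  open import Data.Nat using (suc; _+_; _*_; _≤?_)
  open import Data.Nat.Properties as ℕ using (module ≤-Reasoning)
  open import Data.Nat.Tactic.RingSolver using (solve-∀)
  open import Data.Fin using (toℕ; _<_; _<?_; _≟_)
  open import Data.Fin.Properties using (≤-totalOrder; <-asym; toℕ-injective)
  open import Data.Fin.Subset using (Subset) renaming (_∈_ to _∈ˢ_)
  open import Algebra.Construct.NaturalChoice.Min (≤-totalOrder n) using (_⊓_; x≤y⇒x⊓y≈x; x≤y⇒y⊓x≈x)
  open import Data.List using ([]; _∷_; _++_; map; filter; length; allFin; lookup; cartesianProduct; take; drop)
  open import Data.List.Properties using (length-++; length-map; length-tabulate; length-take; length-drop; take++drop≡id)
  open import Data.List.Membership.Propositional using (_∉_)
  open import Data.List.Membership.Propositional.Properties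
    using ( ∈-filter⁺; ∈-filter⁻; ∈-allFin; ∈-++⁺ˡ; ∈-++⁺ʳ; ∈-++⁻; ∈-map⁺; ∈-map⁻; ∈-lookup
          ; ∈-cartesianProduct⁺)
  open import Data.List.Relation.Binary.Subset.Propositional using (_⊆_)
  open import Data.List.Relation.Unary.All as All using (All; []; _∷_)
  open import Data.List.Relation.Unary.Any as Any using (here; there)
  open import Data.List.Relation.Unary.All.Properties using (++⁻)
  open import Data.List.Relation.Unary.Any.Properties using (lookup-index)
  open import Data.List.Relation.Unary.Unique.Propositional using (Unique; []; _∷_)
  open import Data.List.Relation.Unary.Unique.Propositional.Properties using (filter⁺; allFin⁺; ++⁺; map⁺)
  open import Data.Maybe using (just; fromMaybe; maybe′)
  open import Data.Maybe.Properties using (just-injective; ≡-dec)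
  open import Data.Product using (∃; _×_; _,_; proj₁; proj₂)
  open import Data.Sum using (inj₁; inj₂)
  open import Data.Empty using (⊥; ⊥-elim)
  open import Function.Bundles using (_⇔_; mk⇔)
  open import Relation.Nullary using (Dec; yes; no; ¬_)
  open import Relation.Nullary.Decidable using (_×-dec_; ¬?)
  open import Relation.Binary.PropositionalEquality
    using (refl; sym; trans; cong; cong₂; subst; subst₂; module ≡-Reasoning)
  open import Function using (id; case_of_)
  open import Relation.Binary.Definitions using (tri<; tri≈; tri>)

  Free : Fin n → Set
  Free v = R v ≡ nothing

  free? : ∀ v → Dec (Free v)
  free? v = ≡-dec _≟_ (R v) nothing

  -- The R-partner of opt a; the default a is never used, as opt a is matched whenever a is free.
  across : Fin n → Fin n
  across a = fromMaybe a (R (opt a))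

  farEnd : Fin n → Fin n
  farEnd a = opt (across a)

  R-opt : ∀ {a} → Free a → R (opt a) ≡ just (across a)
  R-opt {a} a-free with R (opt a) | R-maximal a a-free
  ... | just _  | _            = refl
  ... | nothing | opt-a-matched = ⊥-elim (opt-a-matched refl)

  R-across : ∀ {a} → Free a → R (across a) ≡ just (opt a)
  R-across a-free = proj₁ (R-matching _ _ (R-opt a-free))

  opt-injective : ∀ {x y} → opt x ≡ opt y → x ≡ y
  opt-injective {x} {y} eq = trans (sym (opt-involutive x)) (trans (cong opt eq) (opt-involutive y))

  farEnd-involutive : ∀ {a} → Free a → farEnd (farEnd a) ≡ a
  farEnd-involutive {a} a-free
    rewrite opt-involutive (across a) | R-across a-free = opt-involutive a

  farEnd-injective : ∀ {a b} → Free a → Free b → farEnd a ≡ farEnd b → a ≡ b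
  farEnd-injective {a} {b} a-free b-free eq =
    trans (sym (farEnd-involutive a-free)) (trans (cong farEnd eq) (farEnd-involutive b-free))

  farEnd-≢ : ∀ {a} → Free a → farEnd a ≢ a
  farEnd-≢ {a} a-free eq = proj₂ (R-matching _ _ (R-opt a-free))
    (sym (trans (sym (opt-involutive (across a))) (cong opt eq)))

  Augmentable : Fin n → Set
  Augmentable a = Free a × Free (farEnd a)

  PathRep : Fin n → Set
  PathRep a = Augmentable a × a < farEnd a

  pathRep? : ∀ a → Dec (PathRep a)
  pathRep? a = (free? a ×-dec free? (farEnd a)) ×-dec (a <? farEnd a)

  farEnd-pathRep : ∀ {a} → Augmentable a → farEnd a < a → PathRep (farEnd a)
  farEnd-pathRep {a} (a-free , d-free) d<a =
    (d-free , subst Free (sym (farEnd-involutive a-free)) a-free) ,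
    subst (farEnd a <_) (sym (farEnd-involutive a-free)) d<a

  pathRep≢farEnd : ∀ {a b} → PathRep a → PathRep b → a ≢ farEnd b
  pathRep≢farEnd {a} {b} (_ , a<da) ((b-free , _) , b<db) refl =
    <-asym b<db (subst (farEnd b <_) (farEnd-involutive b-free) a<da)

  pathAt : ∀ {a} → Augmentable a → AugPath3 opt R
  pathAt {a} (a-free , d-free) = record
    { a = a ; b = opt a ; c = across a ; d = farEnd a
    ; ab∈OPT = refl ; bc∈R = R-opt a-free ; cd∈OPT = refl
    ; a-free = a-free ; d-free = d-free }

  pathEnd : Fin n → Fin n
  pathEnd v = maybe′ (λ _ → opt v) v (R v)

  pathEnd-free : ∀ {v} → Free v → pathEnd v ≡ v
  pathEnd-free v-free rewrite v-free = refl

  pathEnd-matched : ∀ {v u} → R v ≡ just u → pathEnd v ≡ opt v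
  pathEnd-matched Rv≡u rewrite Rv≡u = refl

  lowerEnd : Fin n → Fin n
  lowerEnd w = w ⊓ farEnd w

  lowerEnd-pathRep : ∀ {a} → PathRep a → lowerEnd a ≡ a
  lowerEnd-pathRep (_ , a<d) = x≤y⇒x⊓y≈x (ℕ.<⇒≤ a<d)

  lowerEnd-farEnd-pathRep : ∀ {a} → PathRep a → lowerEnd (farEnd a) ≡ a
  lowerEnd-farEnd-pathRep {a} ((a-free , _) , a<d) rewrite farEnd-involutive a-free = x≤y⇒y⊓x≈x (ℕ.<⇒≤ a<d)

  -- pathEnd maps each vertex of a path to the path end on its OPT edge, so repOf sends the
  -- whole path of a representative back to it: paths of distinct representatives are disjoint.
  repOf : Fin n → Fin n
  repOf v = lowerEnd (pathEnd v)

  repOf-onPath : ∀ {a} (rep : PathRep a) {v} → OnPath (pathAt (proj₁ rep)) v → repOf v ≡ a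
  repOf-onPath rep@((a-free , d-free) , _) (inj₁ refl) =
    trans (cong lowerEnd (pathEnd-free a-free)) (lowerEnd-pathRep rep)
  repOf-onPath rep@((a-free , d-free) , _) (inj₂ (inj₁ refl)) =
    trans (cong lowerEnd (trans (pathEnd-matched (R-opt a-free)) (opt-involutive _))) (lowerEnd-pathRep rep)
  repOf-onPath rep@((a-free , d-free) , _) (inj₂ (inj₂ (inj₁ refl))) =
    trans (cong lowerEnd (pathEnd-matched (R-across a-free))) (lowerEnd-farEnd-pathRep rep)
  repOf-onPath rep@((a-free , d-free) , _) (inj₂ (inj₂ (inj₂ refl))) =
    trans (cong lowerEnd (pathEnd-free d-free)) (lowerEnd-farEnd-pathRep rep)

  endpoints : List (Fin n) → List (Fin n)
  endpoints as = as ++ map farEnd as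

  length-endpoints : ∀ as → length (endpoints as) ≡ 2 * length as
  length-endpoints as = trans (length-++ as)
    (cong (length as +_) (trans (length-map farEnd as) (sym (ℕ.+-identityʳ (length as)))))

  Unique-endpoints : ∀ {as} → Unique as → All PathRep as → Unique (endpoints as)
  Unique-endpoints {as} uas reps = ++⁺ uas (map⁺-on farEnd farEnd-inj uas) disjoint
    where
    free : ∀ {x} → x ∈ as → Free x
    free x∈ = proj₁ (proj₁ (All.lookup reps x∈))
    farEnd-inj : ∀ {x y} → x ∈ as → y ∈ as → farEnd x ≡ farEnd y → x ≡ y
    farEnd-inj x∈ y∈ = farEnd-injective (free x∈) (free y∈)
    disjoint : ∀ {v} → ¬ (v ∈ as × v ∈ map farEnd as)
    disjoint (v∈ , v∈far) with x , x∈ , refl ← ∈-map⁻ farEnd v∈far =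
      pathRep≢farEnd (All.lookup reps v∈) (All.lookup reps x∈) refl

  endpoints-isKWIS : ∀ {as} → Unique as → All PathRep as → IsKWIS opt R (length as) (toSubset (endpoints as))
  endpoints-isKWIS {as} uas reps =
    trans (∣toSubset∣ (Unique-endpoints uas reps)) (length-endpoints as) , P , P-disjoint , endpoints⇔
    where
    rep : ∀ i → PathRep (lookup as i)
    rep i = All.lookup reps (∈-lookup i)

    P : Fin (length as) → AugPath3 opt R
    P i = pathAt (proj₁ (rep i))

    P-disjoint : ∀ i j → i ≢ j → ∀ v → OnPath (P i) v → OnPath (P j) v → ⊥
    P-disjoint i j i≢j v v∈Pi v∈Pj =
      i≢j (lookup-injective uas (trans (sym (repOf-onPath (rep i) v∈Pi)) (repOf-onPath (rep j) v∈Pj)))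

    endpoints⇔ : ∀ v → (v ∈ˢ toSubset (endpoints as)) ⇔ (∃ λ i → Endpoint (P i) v)
    endpoints⇔ v = mk⇔ to from
      where
      to : v ∈ˢ toSubset (endpoints as) → ∃ λ i → Endpoint (P i) v
      to v∈ with ∈-++⁻ as (∈toSubset⁻ (endpoints as) v∈)
      ... | inj₁ v∈as = Any.index v∈as , inj₁ (lookup-index v∈as)
      ... | inj₂ v∈far with x , x∈ , refl ← ∈-map⁻ farEnd v∈far =
        Any.index x∈ , inj₂ (cong farEnd (lookup-index x∈))
      from : (∃ λ i → Endpoint (P i) v) → v ∈ˢ toSubset (endpoints as)
      from (i , inj₁ refl) = ∈toSubset⁺ (endpoints as) (∈-++⁺ˡ (∈-lookup {xs = as} i))
      from (i , inj₂ refl) = ∈toSubset⁺ (endpoints as) (∈-++⁺ʳ as (∈-map⁺ farEnd (∈-lookup i)))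

  1≤#0-WIS : ∀ {w} → IsCount (IsKWIS opt R 0) w → 1 ℕ.≤ w
  1≤#0-WIS count = IsCount⇒length≤ count ([] ∷ []) λ { (here refl) → endpoints-isKWIS [] [] }

  length≤#WIS : ∀ {w} ys xs → IsCount (IsKWIS opt R (suc (length ys))) w →
                    Unique (ys ++ xs) → All PathRep (ys ++ xs) → length xs ℕ.≤ w
  length≤#WIS {w} ys xs count uysxs reps =
    subst (ℕ._≤ w) (length-map W xs) (IsCount⇒length≤ count (map⁺-on W W-injective uxs) W-isKWIS)
    where
    uys : Unique ys
    uys = proj₁ (Unique-++⁻ ys uysxs)
    uxs : Unique xs
    uxs = proj₁ (proj₂ (Unique-++⁻ ys uysxs))
    ys#xs : ∀ {v} → v ∈ ys → v ∉ xs
    ys#xs = proj₂ (proj₂ (Unique-++⁻ ys uysxs))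
    ys-reps : All PathRep ys
    ys-reps = proj₁ (++⁻ ys reps)
    xs-reps : All PathRep xs
    xs-reps = proj₂ (++⁻ ys reps)

    W : Fin n → Subset n
    W x = toSubset (endpoints (x ∷ ys))

    W-isKWIS : ∀ {V} → V ∈ map W xs → IsKWIS opt R (suc (length ys)) V
    W-isKWIS V∈ with x , x∈ , refl ← ∈-map⁻ W V∈ =
      endpoints-isKWIS (All.tabulate (λ { y∈ refl → ys#xs y∈ x∈ }) ∷ uys) (All.lookup xs-reps x∈ ∷ ys-reps)

    W-injective : ∀ {x x′} → x ∈ xs → x′ ∈ xs → W x ≡ W x′ → x ≡ x′
    W-injective {x} {x′} x∈ x′∈ eq
      with ∈-++⁻ (x′ ∷ ys) (∈toSubset⁻ (endpoints (x′ ∷ ys))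
                             (subst (x ∈ˢ_) eq (∈toSubset⁺ (endpoints (x ∷ ys)) (here refl))))
    ... | inj₁ (here x≡x′)  = x≡x′
    ... | inj₁ (there x∈ys) = ⊥-elim (ys#xs x∈ys x∈)
    ... | inj₂ x∈far with y , y∈ , refl ← ∈-map⁻ farEnd x∈far =
      ⊥-elim (pathRep≢farEnd (All.lookup xs-reps x∈) (All.lookup (All.lookup xs-reps x′∈ ∷ ys-reps) y∈) refl)

  length≤#WIS+k : ∀ {k w} → IsCount (IsKWIS opt R (suc k)) w →
                   ∀ {as} → Unique as → All PathRep as → length as ℕ.≤ w + k
  length≤#WIS+k {k} {w} count {as} uas reps with k ≤? length as
  ... | no  k≰as = ℕ.≤-trans (ℕ.<⇒≤ (ℕ.≰⇒> k≰as)) (ℕ.m≤n+m k w)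
  ... | yes k≤as = begin
    length as              ≡⟨ ℕ.m∸n+n≡m k≤as ⟨
    length as ℕ.∸ k + k    ≡⟨ cong (_+ k) (length-drop k as) ⟨
    length (drop k as) + k ≤⟨ ℕ.+-monoˡ-≤ k (length≤#WIS (take k as) (drop k as) count′
                                (subst Unique (sym split) uas) (subst (All PathRep) (sym split) reps)) ⟩
    w + k                  ∎
    where
    open ≤-Reasoning
    split : take k as ++ drop k as ≡ as
    split = take++drop≡id k as
    count′ : IsCount (IsKWIS opt R (suc (length (take k as)))) w
    count′ = subst (λ m → IsCount (IsKWIS opt R (suc m)) w)
               (sym (trans (length-take k as) (ℕ.m≤n⇒m⊓n≡m k≤as))) count

  Matched : Fin n → Set
  Matched v = ¬ Free v

  Blocked : Fin n → Set
  Blocked a = Free a × Matched (farEnd a)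

  matched? : ∀ v → Dec (Matched v)
  matched? v = ¬? (free? v)

  augmentable? : ∀ a → Dec (Augmentable a)
  augmentable? a = free? a ×-dec free? (farEnd a)

  blocked? : ∀ a → Dec (Blocked a)
  blocked? a = free? a ×-dec matched? (farEnd a)

  vertices freeVertices matchedVertices augmentableVertices blockedVertices pathReps : List (Fin n)
  vertices            = allFin n
  freeVertices        = filter free? vertices
  matchedVertices     = filter matched? vertices
  augmentableVertices = filter augmentable? vertices
  blockedVertices     = filter blocked? vertices
  pathReps            = filter pathRep? vertices

  module _ {P : Fin n → Set} (P? : ∀ v → Dec (P v)) where

    select : ∀ {v} → P v → v ∈ filter P? vertices
    select = ∈-filter⁺ P? (∈-allFin _)

    selected : ∀ {v} → v ∈ filter P? vertices → P v
    selected v∈ = proj₂ (∈-filter⁻ P? {xs = vertices} v∈)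

    Unique-selection : Unique (filter P? vertices)
    Unique-selection = filter⁺ P? (allFin⁺ n)

  n≤#free+#matched : n ℕ.≤ length freeVertices + length matchedVertices
  n≤#free+#matched = subst₂ ℕ._≤_ (length-tabulate id) (length-++ freeVertices)
    (Unique⇒length≤ (allFin⁺ n) split)
    where
    split : vertices ⊆ freeVertices ++ matchedVertices
    split {v} _ with free? v
    ... | yes v-free    = ∈-++⁺ˡ (select free? v-free)
    ... | no  v-matched = ∈-++⁺ʳ freeVertices (select matched? v-matched)

  #free≤#augmentable+#blocked : length freeVertices ℕ.≤ length augmentableVertices + length blockedVertices
  #free≤#augmentable+#blocked = subst (length freeVertices ℕ.≤_) (length-++ augmentableVertices)
    (Unique⇒length≤ (Unique-selection free?) split)
    where
    split : freeVertices ⊆ augmentableVertices ++ blockedVertices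
    split {a} a∈ with free? (farEnd a)
    ... | yes d-free    = ∈-++⁺ˡ (select augmentable? (selected free? a∈ , d-free))
    ... | no  d-matched = ∈-++⁺ʳ augmentableVertices (select blocked? (selected free? a∈ , d-matched))

  #free+#blocked≤#matched : length freeVertices + length blockedVertices ℕ.≤ length matchedVertices
  #free+#blocked≤#matched = subst (ℕ._≤ length matchedVertices) lengths
    (Unique⇒length≤ (++⁺ (map⁺ opt-injective (Unique-selection free?))
                         (map⁺-on across across-injective (Unique-selection blocked?))
                         disjoint)
                    matched)
    where
    lengths : length (map opt freeVertices ++ map across blockedVertices) ≡
              length freeVertices + length blockedVertices
    lengths = trans (length-++ (map opt freeVertices))
                    (cong₂ _+_ (length-map opt freeVertices) (length-map across blockedVertices))
    across-injective : ∀ {a b} → a ∈ blockedVertices → b ∈ blockedVertices → across a ≡ across b → a ≡ b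
    across-injective {a} {b} a∈ b∈ eq = opt-injective (just-injective (begin
      just (opt a)   ≡⟨ R-across (proj₁ (selected blocked? a∈)) ⟨
      R (across a)   ≡⟨ cong R eq ⟩
      R (across b)   ≡⟨ R-across (proj₁ (selected blocked? b∈)) ⟩
      just (opt b)   ∎))
      where open ≡-Reasoning
    disjoint : ∀ {v} → ¬ (v ∈ map opt freeVertices × v ∈ map across blockedVertices)
    disjoint (v∈ , v∈′) with a , a∈ , refl ← ∈-map⁻ opt v∈ | b , b∈ , eq ← ∈-map⁻ across v∈′ =
      proj₂ (selected blocked? b∈) (subst Free (trans (sym (opt-involutive a)) (cong opt eq)) (selected free? a∈))
    matched : map opt freeVertices ++ map across blockedVertices ⊆ matchedVertices
    matched v∈ with ∈-++⁻ (map opt freeVertices) v∈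
    ... | inj₁ v∈opt with a , a∈ , refl ← ∈-map⁻ opt v∈opt = select matched? (R-maximal a (selected free? a∈))
    ... | inj₂ v∈across with a , a∈ , refl ← ∈-map⁻ across v∈across =
      select matched? λ c-free → case trans (sym (R-across (proj₁ (selected blocked? a∈)))) c-free of λ ()

  #augmentable≤2#pathReps : length augmentableVertices ℕ.≤ 2 * length pathReps
  #augmentable≤2#pathReps = subst (length augmentableVertices ℕ.≤_) (length-endpoints pathReps)
    (Unique⇒length≤ (Unique-selection augmentable?) covered)
    where
    covered : augmentableVertices ⊆ endpoints pathReps
    covered {a} a∈ with ℕ.<-cmp (toℕ a) (toℕ (farEnd a))
    ... | tri< a<d _ _ = ∈-++⁺ˡ (select pathRep? (selected augmentable? a∈ , a<d))
    ... | tri≈ _ a≡d _ = ⊥-elim (farEnd-≢ (proj₁ (selected augmentable? a∈)) (sym (toℕ-injective a≡d)))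
    ... | tri> _ _ d<a = ∈-++⁺ʳ pathReps
      (subst (_∈ map farEnd pathReps) (farEnd-involutive (proj₁ (selected augmentable? a∈)))
             (∈-map⁺ farEnd (select pathRep? (farEnd-pathRep (selected augmentable? a∈) d<a))))

  -- Ranking.sizeR filters with a decider local to Defs, so edges is taken over an arbitrary
  -- decider of the same predicate, which then unifies with it.
  module _ (edge? : ∀ p → Dec (toℕ (proj₁ p) ℕ.< toℕ (proj₂ p) × R (proj₁ p) ≡ just (proj₂ p))) where

    edges : List (Fin n × Fin n)
    edges = filter edge? (cartesianProduct vertices vertices)

    #matched≤2#edges : length matchedVertices ℕ.≤ 2 * length edges
    #matched≤2#edges = subst (length matchedVertices ℕ.≤_) lengths
      (Unique⇒length≤ (Unique-selection matched?) covered)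
      where
      lengths : length (map proj₁ edges ++ map proj₂ edges) ≡ 2 * length edges
      lengths = trans (length-++ (map proj₁ edges))
        (cong₂ _+_ (length-map proj₁ edges)
                   (trans (length-map proj₂ edges) (sym (ℕ.+-identityʳ (length edges)))))
      covered : matchedVertices ⊆ map proj₁ edges ++ map proj₂ edges
      covered {v} v∈ with R v in Rv | selected matched? v∈
      ... | nothing | v-matched = ⊥-elim (v-matched refl)
      ... | just u  | _ with ℕ.<-cmp (toℕ v) (toℕ u)
      ...   | tri< v<u _ _ = ∈-++⁺ˡ (∈-map⁺ proj₁
                (∈-filter⁺ edge? (∈-cartesianProduct⁺ (∈-allFin v) (∈-allFin u)) (v<u , Rv)))
      ...   | tri≈ _ v≡u _ = ⊥-elim (proj₂ (R-matching v u Rv) (toℕ-injective v≡u))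
      ...   | tri> _ _ u<v = ∈-++⁺ʳ (map proj₁ edges) (∈-map⁺ proj₂ {x = u , v}
                (∈-filter⁺ edge? (∈-cartesianProduct⁺ (∈-allFin u) (∈-allFin v))
                  (u<v , proj₁ (R-matching v u Rv))))

    n≤#pathReps+3#edges : n ℕ.≤ length pathReps + 3 * length edges
    n≤#pathReps+3#edges = vertex-count-bound {A = length pathReps} {P = length edges}
      n≤#free+#matched #free≤#augmentable+#blocked #free+#blocked≤#matched
      #augmentable≤2#pathReps #matched≤2#edges

    n<#WIS+3#edges+k : ∀ {k w} → IsCount (IsKWIS opt R (suc k)) w →
                       suc n ℕ.≤ (w + 3 * length edges) + suc k
    n<#WIS+3#edges+k {k} {w} count = begin-strict
      n                                  ≤⟨ n≤#pathReps+3#edges ⟩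
      length pathReps + 3 * length edges ≤⟨ ℕ.+-monoˡ-≤ _ #pathReps≤#WIS+k ⟩
      (w + k) + 3 * length edges         <⟨ ℕ.n<1+n _ ⟩
      suc ((w + k) + 3 * length edges)   ≡⟨ regroup w k (3 * length edges) ⟩
      (w + 3 * length edges) + suc k     ∎
      where
      open ≤-Reasoning
      #pathReps≤#WIS+k : length pathReps ℕ.≤ w + k
      #pathReps≤#WIS+k = length≤#WIS+k count (Unique-selection pathRep?) (All.tabulate (selected pathRep?))
      regroup : ∀ w k e → suc ((w + k) + e) ≡ (w + e) + suc k
      regroup = solve-∀

module ExpectedCounts {n : ℕ} {E : Fin n → Fin n → Set} (E? : Decidable E) (irr : Irreflexive′ E)
  (opt : Fin n → Fin n) (opt-edge : ∀ v → E v (opt v)) (opt-involutive : ∀ v → opt (opt v) ≡ v)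
  (wis : List (Fin n) → ℕ) where

  open Ranking E?
  open Permutations
  open Sums
  open RankingMatching
  open import Data.Nat using (suc; _+_; _*_; _≤_; _!)
  open import Data.Nat.Properties using (*-identityʳ; *-zeroʳ; +-identityʳ)
  open import Data.Nat.ListAction using (sum)
  open import Data.List using (map; length)
  open import Relation.Binary.PropositionalEquality using (sym; trans; cong; cong₂; subst; subst₂)

  module Paths {σ} (σ∈ : σ ∈ orders n) = AugmentingPaths opt (ranking σ) (ranking-isMatching E? irr σ)
    opt-involutive
    (λ a a-free → ranking-saturates E? σ (∈-orders σ∈ a) a-free (opt a) (∈-orders σ∈ (opt a)) (opt-edge a))

  n!≤Σwis₀ : (∀ σ → σ ∈ orders n → IsCount (IsKWIS opt (ranking σ) 0) (wis σ)) →
             n ! ≤ sum (map wis (orders n))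
  n!≤Σwis₀ counts = subst₂ _≤_ (trans (*-identityʳ (length (orders n))) (length-orders n))
    (trans (cong (sum (map wis (orders n)) +_) (*-zeroʳ (length (orders n)))) (+-identityʳ _))
    (sum-map-lowerBound {a = 1} {b = 0} wis (orders n)
      λ {σ} σ∈ → subst (1 ≤_) (sym (+-identityʳ (wis σ))) (Paths.1≤#0-WIS σ∈ (counts σ σ∈)))

  n![1+n]≤Σwis+3Σsize+n![1+k] :
    ∀ {k} → (∀ σ → σ ∈ orders n → IsCount (IsKWIS opt (ranking σ) (suc k)) (wis σ)) →
    n ! * suc n ≤ (sum (map wis (orders n)) + 3 * sum (map sizeR (orders n))) + n ! * suc k
  n![1+n]≤Σwis+3Σsize+n![1+k] {k} counts = subst₂ _≤_ (cong (_* suc n) (length-orders n))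
    (cong₂ _+_ (trans (sum-map-+ wis (λ σ → 3 * sizeR σ) (orders n))
                      (cong (sum (map wis (orders n)) +_) (sum-map-*ˡ 3 sizeR (orders n))))
               (cong (_* suc k) (length-orders n)))
    (sum-map-lowerBound (λ σ → wis σ + 3 * sizeR σ) (orders n)
      λ {σ} σ∈ → Paths.n<#WIS+3#edges+k σ∈ _ (counts σ σ∈))

open import Data.Nat using (zero; suc; _!)
open import Data.Nat.Properties using (_!≢0)
open import Data.Nat.ListAction using (sum)
open import Data.List using (map)
open import Data.Product using (_,_)
open import Data.Integer using (+_)
open import Data.Rational using (ℚ; 0ℚ; 1ℚ; ½; _≤_; _+_; _-_; _*_; _/_)
open RationalArithmetic using (1≤/; scaled-budget)
open NatArithmetic using (cancel-budget)

lemma2p2 : (n : ℕ) (E : Fin n → Fin n → Set) (E? : Decidable E) →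
    Symmetric′ E → Irreflexive′ E →
    (opt : Fin n → Fin n) → IsPerfectMatching E opt →
    (c : ℚ) → 0ℚ ≤ c → c ≤ (+ 1) / 6 →
    (k : ℕ) → ℚ[ k ] ≡ (½ - ℚ[ 3 ] * c) * (ℚ[ n ] * ½) →
    Expect n (Ranking.sizeR E?) ≤ (½ + c) * (ℚ[ n ] * ½) →
    (wis : List (Fin n) → ℕ) →
    (∀ σ → σ ∈ orders n → IsCount (IsKWIS opt (Ranking.ranking E? σ) k) (wis σ)) →
    1ℚ ≤ Expect n wis
lemma2p2 n E E? _ irr opt (opt-edge , opt-involutive , _) c _ _ zero _ _ wis counts =
  1≤/ (sum (map wis (orders n))) (n !) {{n !≢0}} (n!≤Σwis₀ counts)
  where open ExpectedCounts E? irr opt opt-edge opt-involutive wis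
lemma2p2 n E E? _ irr opt (opt-edge , opt-involutive , _) c _ _ (suc k) k≡ E|R|≤ wis counts =
  1≤/ (sum (map wis (orders n))) (n !) {{n !≢0}}
    (cancel-budget (n![1+n]≤Σwis+3Σsize+n![1+k] counts)
                   (scaled-budget (n !) (sum (map sizeR (orders n))) {{n !≢0}} c k≡ E|R|≤))
  where
  open Ranking E?
  open ExpectedCounts E? irr opt opt-edge opt-involutive wis
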